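{- Let $n$ be an even, sufficiently large positive integer and suppose $t\le n-\frac12\log n-2$. If $\{0,1\}^n$ is partitioned into $2^t$ disjoint sets, then one of those sets must be crossed.
   Context: Logarithms are base $2$. For $x,x'\in\{0,1\}^n$ and $a,b\in\{0,1\}$, let $I_{ab}(x,x')=\{j\in[n]:(x_j,x'_j)=(a,b)\}$. A pair $(x,x')$ is a crossing pair if $I_{ab}(x,x')\ne\emptyset$ for all four choices of $a,b\in\{0,1\}$. A set $T\subseteq\{0,1\}^n$ is crossed if it contains a crossing pair and uncrossed otherwise. -}

module Defs where

open import Data.Nat using (ℕ; _+_; _*_; _∸_; _^_; _≤_)
open import Data.Fin using (Fin)
open import Data.Bool using (Bool)
open import Data.Product using (Σ; ∃; _×_)
open import Relation.Binary.PropositionalEquality using (_≡_)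

-- Points of {0,1}^n, as functions Fin n → Bool (false = 0, true = 1).
Cube : ℕ → Set
Cube n = Fin n → Bool

INonempty : ∀ {n} → Cube n → Cube n → Bool → Bool → Set
INonempty {n} x x' a b = Σ (Fin n) λ j → (x j ≡ a) × (x' j ≡ b)

CrossingPair : ∀ {n} → Cube n → Cube n → Set
CrossingPair x x' = ∀ a b → INonempty x x' a b

-- Real-number condition  t ≤ n - (1/2) log₂ n - 2  for naturals n ≥ 1, t,
-- equivalently  log₂ n ≤ 2(n - t - 2), i.e.  t + 2 ≤ n  and  n ≤ 2^(2(n-t-2)).
TBound : ℕ → ℕ → Set
TBound n t = (t + 2 ≤ n) × (n ≤ 2 ^ (2 * (n ∸ t ∸ 2)))

-- Take the vectors of weight n/2 whose first coordinate is 1. Two distinct such vectors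
-- form a crossing pair: both have a 1 in the first coordinate, equal weights force as many
-- (1,0) as (0,1) coordinates (at least one, as they differ), and weight n/2 forces as many
-- (0,0) as (1,1) coordinates. Writing n = 2p + 2, there are h p = C(2p+1, p) of them, and
-- since (p+2) h (p+1) = 2 (2p+3) h p and (2p+3)² > 4 (p+1) (p+2), induction gives
-- 16^p ≤ (p+1) (h p)². Under the bound on t this yields 2^t < h p, so by pigeonhole two of
-- these vectors fall into the same part.
module Submission where

open import Defs
open import Data.Nat using (ℕ; zero; suc; _+_; _*_; _∸_; _^_; _≤_; _<_; z≤n; s≤s; s≤s⁻¹)
open import Data.Nat.Properties hiding (_≟_)
open import Data.Nat.Divisibility using (_∣_; divides)
open import Data.Nat.Tactic.RingSolver using (solve-∀)
open import Data.Bool using (Bool; true; false)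
open import Data.Bool.Properties using (_≟_)
open import Data.Fin using (Fin; zero; suc; splitAt; join)
open import Data.Fin.Properties using (join-splitAt; pigeonhole) renaming (<⇒≢ to <⇒≢ᶠ)
open import Data.Vec using (Vec; []; _∷_; lookup)
open import Data.Vec.Properties using (∷-injectiveʳ)
open import Data.Sum using (_⊎_; inj₁; inj₂)
open import Data.Product using (Σ; _×_; _,_)
open import Function using (_∘_)
open import Relation.Nullary using (yes; no; contradiction)
open import Relation.Binary.PropositionalEquality

private
  variable
    n : ℕ

weight : Vec Bool n → ℕ
weight [] = 0
weight (true ∷ u) = suc (weight u)
weight (false ∷ u) = weight u

count : Bool → Bool → Vec Bool n → Vec Bool n → ℕ
count a b [] [] = 0
count a b (x ∷ u) (y ∷ v) with x ≟ a | y ≟ b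
... | yes _ | yes _ = suc (count a b u v)
... | _     | _     = count a b u v

nonempty-∷ : ∀ {a b x y} {u v : Vec Bool n} → INonempty (lookup u) (lookup v) a b →
             INonempty (lookup (x ∷ u)) (lookup (y ∷ v)) a b
nonempty-∷ (j , p) = suc j , p

count-pos⇒nonempty : ∀ a b (u v : Vec Bool n) → 0 < count a b u v →
                     INonempty (lookup u) (lookup v) a b
count-pos⇒nonempty a b [] [] ()
count-pos⇒nonempty a b (x ∷ u) (y ∷ v) pos with x ≟ a | y ≟ b
... | yes x≡a | yes y≡b = zero , x≡a , y≡b
... | yes _   | no _    = nonempty-∷ (count-pos⇒nonempty a b u v pos)
... | no _    | _       = nonempty-∷ (count-pos⇒nonempty a b u v pos)

weight-split₁ : (u v : Vec Bool n) → weight u ≡ count true true u v + count true false u v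
weight-split₁ [] [] = refl
weight-split₁ (true ∷ u) (true ∷ v) = cong suc (weight-split₁ u v)
weight-split₁ (true ∷ u) (false ∷ v) = trans (cong suc (weight-split₁ u v)) (sym (+-suc _ _))
weight-split₁ (false ∷ u) (true ∷ v) = weight-split₁ u v
weight-split₁ (false ∷ u) (false ∷ v) = weight-split₁ u v

weight-split₂ : (u v : Vec Bool n) → weight v ≡ count true true u v + count false true u v
weight-split₂ [] [] = refl
weight-split₂ (true ∷ u) (true ∷ v) = cong suc (weight-split₂ u v)
weight-split₂ (true ∷ u) (false ∷ v) = weight-split₂ u v
weight-split₂ (false ∷ u) (true ∷ v) = trans (cong suc (weight-split₂ u v)) (sym (+-suc _ _))
weight-split₂ (false ∷ u) (false ∷ v) = weight-split₂ u v

length-split : (u v : Vec Bool n) → n ≡ weight u + (count false true u v + count false false u v)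
length-split [] [] = refl
length-split (true ∷ u) (true ∷ v) = cong suc (length-split u v)
length-split (true ∷ u) (false ∷ v) = cong suc (length-split u v)
length-split (false ∷ u) (true ∷ v) = trans (cong suc (length-split u v)) (sym (+-suc _ _))
length-split (false ∷ u) (false ∷ v) =
  trans (cong suc (length-split u v)) (sym (trans (cong (weight u +_) (+-suc _ _)) (+-suc _ _)))

no-disagreement⇒≡ : (u v : Vec Bool n) → count true false u v ≡ 0 → count false true u v ≡ 0 → u ≡ v
no-disagreement⇒≡ [] [] _ _ = refl
no-disagreement⇒≡ (true ∷ u) (true ∷ v) p q = cong (true ∷_) (no-disagreement⇒≡ u v p q)
no-disagreement⇒≡ (false ∷ u) (false ∷ v) p q = cong (false ∷_) (no-disagreement⇒≡ u v p q)
no-disagreement⇒≡ (true ∷ u) (false ∷ v) () _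
no-disagreement⇒≡ (false ∷ u) (true ∷ v) _ ()

balanced⇒crossing : (u v : Vec Bool n) → weight u ≡ weight v → n ≡ weight u + weight u → u ≢ v →
                    0 < count true true u v → CrossingPair (lookup u) (lookup v)
balanced⇒crossing u v same-weight half-length u≢v A>0 = crossing
  where
  A = count true true u v
  B = count true false u v
  C = count false true u v
  D = count false false u v
  B≡C : B ≡ C
  B≡C = +-cancelˡ-≡ A B C (trans (sym (weight-split₁ u v)) (trans same-weight (weight-split₂ u v)))
  D≡A : D ≡ A
  D≡A = +-cancelʳ-≡ C D A (begin
    D + C                ≡⟨ +-comm D C ⟩
    C + D                ≡⟨ +-cancelˡ-≡ (weight u) _ _ (trans (sym (length-split u v)) half-length) ⟩
    weight u             ≡⟨ same-weight ⟩
    weight v             ≡⟨ weight-split₂ u v ⟩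
    A + C                ∎)
    where open ≡-Reasoning
  B>0 : 0 < B
  B>0 = n≢0⇒n>0 λ B≡0 → u≢v (no-disagreement⇒≡ u v B≡0 (trans (sym B≡C) B≡0))
  crossing : CrossingPair (lookup u) (lookup v)
  crossing true true = count-pos⇒nonempty true true u v A>0
  crossing true false = count-pos⇒nonempty true false u v B>0
  crossing false true = count-pos⇒nonempty false true u v (subst (0 <_) B≡C B>0)
  crossing false false = count-pos⇒nonempty false false u v (subst (0 <_) (sym D≡A) A>0)

binomial : ℕ → ℕ → ℕ
binomial n zero = 1
binomial zero (suc k) = 0
binomial (suc n) (suc k) = binomial n k + binomial n (suc k)

combination : ∀ n k → Fin (binomial n k) → Vec Bool n
combination-by-head : ∀ n k → Fin (binomial n k) ⊎ Fin (binomial n (suc k)) → Vec Bool (suc n)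
combination zero zero _ = []
combination (suc n) zero i = false ∷ combination n zero i
combination (suc n) (suc k) i = combination-by-head n k (splitAt (binomial n k) i)
combination-by-head n k (inj₁ i) = true ∷ combination n k i
combination-by-head n k (inj₂ i) = false ∷ combination n (suc k) i

weight-combination : ∀ n k i → weight (combination n k i) ≡ k
weight-combination-by-head : ∀ n k i → weight (combination-by-head n k i) ≡ suc k
weight-combination zero zero _ = refl
weight-combination (suc n) zero i = weight-combination n zero i
weight-combination (suc n) (suc k) i = weight-combination-by-head n k (splitAt (binomial n k) i)
weight-combination-by-head n k (inj₁ i) = cong suc (weight-combination n k i)
weight-combination-by-head n k (inj₂ i) = weight-combination n (suc k) i

combination-injective : ∀ n k {i j} → combination n k i ≡ combination n k j → i ≡ j
combination-by-head-injective : ∀ n k {i j} → combination-by-head n k i ≡ combination-by-head n k j → i ≡ j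
combination-injective zero zero {zero} {zero} _ = refl
combination-injective (suc n) zero eq = combination-injective n zero (∷-injectiveʳ eq)
combination-injective (suc n) (suc k) {i} {j} eq = begin
  i                                                ≡⟨ join-splitAt (binomial n k) _ i ⟨
  join (binomial n k) _ (splitAt (binomial n k) i) ≡⟨ cong (join (binomial n k) _) (combination-by-head-injective n k eq) ⟩
  join (binomial n k) _ (splitAt (binomial n k) j) ≡⟨ join-splitAt (binomial n k) _ j ⟩
  j                                                ∎
  where open ≡-Reasoning
combination-by-head-injective n k {inj₁ i} {inj₁ j} eq = cong inj₁ (combination-injective n k (∷-injectiveʳ eq))
combination-by-head-injective n k {inj₂ i} {inj₂ j} eq = cong inj₂ (combination-injective n (suc k) (∷-injectiveʳ eq))
combination-by-head-injective n k {inj₁ i} {inj₂ j} ()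
combination-by-head-injective n k {inj₂ i} {inj₁ j} ()

binomial-1 : ∀ n → binomial n 1 ≡ n
binomial-1 zero = refl
binomial-1 (suc n) = cong suc (binomial-1 n)

binomial-absorption : ∀ n k → suc k * binomial (suc n) (suc k) ≡ suc n * binomial n k
binomial-absorption zero zero = refl
binomial-absorption zero (suc k) = *-zeroʳ (suc (suc k))
binomial-absorption (suc n) zero =
  trans (+-identityʳ _) (cong suc (trans (binomial-1 (suc n)) (sym (*-identityʳ (suc n)))))
binomial-absorption (suc n) (suc k) = begin
  suc (suc k) * (X + Y)
    ≡⟨ *-distribˡ-+ (suc (suc k)) X Y ⟩
  (X + suc k * X) + suc (suc k) * Y
    ≡⟨ +-assoc X _ _ ⟩
  X + (suc k * X + suc (suc k) * Y)
    ≡⟨ cong (X +_) (cong₂ _+_ (binomial-absorption n k) (binomial-absorption n (suc k))) ⟩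
  X + (suc n * binomial n k + suc n * binomial n (suc k))
    ≡⟨ cong (X +_) (*-distribˡ-+ (suc n) (binomial n k) (binomial n (suc k))) ⟨
  X + suc n * X ∎
  where
  open ≡-Reasoning
  X = binomial (suc n) (suc k)
  Y = binomial (suc n) (suc (suc k))

halfCentralBinomial : ℕ → ℕ
halfCentralBinomial p = binomial (suc (p * 2)) p

centralBinomial≡2*half : ∀ p → binomial (suc (suc (p * 2))) (suc p) ≡ 2 * halfCentralBinomial p
centralBinomial≡2*half p = *-cancelˡ-≡ _ _ (suc p)
  (trans (binomial-absorption (suc (p * 2)) p) (rearrange p (halfCentralBinomial p)))
  where
  rearrange : ∀ p h → suc (suc (p * 2)) * h ≡ suc p * (2 * h)
  rearrange = solve-∀

halfCentralBinomial-symmetric : ∀ p → binomial (suc (p * 2)) (suc p) ≡ halfCentralBinomial p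
halfCentralBinomial-symmetric p = +-cancelˡ-≡ h _ _
  (trans (centralBinomial≡2*half p) (cong (h +_) (+-identityʳ h)))
  where h = halfCentralBinomial p

halfCentralBinomial-growth : ∀ p → suc (suc p) * halfCentralBinomial (suc p) ≡
                                   suc (suc (suc (p * 2))) * (2 * halfCentralBinomial p)
halfCentralBinomial-growth p = begin
  suc (suc p) * halfCentralBinomial (suc p)
    ≡⟨ cong (suc (suc p) *_) (halfCentralBinomial-symmetric (suc p)) ⟨
  suc (suc p) * binomial (suc (suc (suc (p * 2)))) (suc (suc p))
    ≡⟨ binomial-absorption (suc (suc (p * 2))) (suc p) ⟩
  suc (suc (suc (p * 2))) * binomial (suc (suc (p * 2))) (suc p)
    ≡⟨ cong (suc (suc (suc (p * 2))) *_) (centralBinomial≡2*half p) ⟩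
  suc (suc (suc (p * 2))) * (2 * halfCentralBinomial p) ∎
  where open ≡-Reasoning

halfCentralBinomial-lower-bound : ∀ p → 2 ^ (p * 4) ≤ suc p * (halfCentralBinomial p * halfCentralBinomial p)
halfCentralBinomial-lower-bound zero = s≤s z≤n
halfCentralBinomial-lower-bound (suc p) = *-cancelˡ-≤ (suc (suc p)) (begin
  suc (suc p) * 2 ^ (suc p * 4)
    ≡⟨ sixteenfold (suc (suc p)) (2 ^ (p * 4)) ⟩
  16 * (suc (suc p) * 2 ^ (p * 4))
    ≤⟨ *-monoʳ-≤ 16 (*-monoʳ-≤ (suc (suc p)) (halfCentralBinomial-lower-bound p)) ⟩
  16 * (suc (suc p) * (suc p * (h * h)))
    ≡⟨ regroup (suc p) (suc (suc p)) h ⟩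
  4 * (suc p * suc (suc p)) * (4 * (h * h))
    ≤⟨ *-monoˡ-≤ (4 * (h * h)) (m≤m+n (4 * (suc p * suc (suc p))) 1) ⟩
  (4 * (suc p * suc (suc p)) + 1) * (4 * (h * h))
    ≡⟨ cong (_* (4 * (h * h))) (square-of-odd p) ⟨
  m * m * (4 * (h * h))
    ≡⟨ regroup′ m h ⟩
  (m * (2 * h)) * (m * (2 * h))
    ≡⟨ cong₂ _*_ (halfCentralBinomial-growth p) (halfCentralBinomial-growth p) ⟨
  (suc (suc p) * h′) * (suc (suc p) * h′)
    ≡⟨ square-of-product (suc (suc p)) h′ ⟩
  suc (suc p) * (suc (suc p) * (h′ * h′)) ∎)
  where
  open ≤-Reasoning
  h = halfCentralBinomial p
  h′ = halfCentralBinomial (suc p)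
  m = suc (suc (suc (p * 2)))
  sixteenfold : ∀ a x → a * (2 * (2 * (2 * (2 * x)))) ≡ 16 * (a * x)
  sixteenfold = solve-∀
  regroup : ∀ a b h → 16 * (b * (a * (h * h))) ≡ 4 * (a * b) * (4 * (h * h))
  regroup = solve-∀
  square-of-odd : ∀ p → suc (suc (suc (p * 2))) * suc (suc (suc (p * 2))) ≡ 4 * (suc p * suc (suc p)) + 1
  square-of-odd = solve-∀
  regroup′ : ∀ m h → m * m * (4 * (h * h)) ≡ (m * (2 * h)) * (m * (2 * h))
  regroup′ = solve-∀
  square-of-product : ∀ a x → (a * x) * (a * x) ≡ a * (a * (x * x))
  square-of-product = solve-∀

square-cancel-< : ∀ {x y} → x * x < y * y → x < y
square-cancel-< x²<y² = ≰⇒> λ y≤x → <⇒≱ x²<y² (*-mono-≤ y≤x y≤x)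

TBound⇒2^t<halfCentralBinomial : ∀ p t → TBound (suc p * 2) t → 2 ^ t < halfCentralBinomial p
TBound⇒2^t<halfCentralBinomial p t (t+2≤n , n≤4^s) = square-cancel-< (begin-strict
  x * x                     <⟨ m<m+n (x * x) (*-mono-< (m^n>0 2 t) (m^n>0 2 t)) ⟩
  x * x + x * x             ≤⟨ *-cancelˡ-≤ (suc p) (begin
    suc p * (x * x + x * x)     ≡⟨ rearrange p (x * x) ⟩
    x * x * suc (suc (p * 2))   ≤⟨ *-monoʳ-≤ (x * x) (subst (λ r → suc (suc (p * 2)) ≤ 2 ^ (2 * r)) n∸t∸2≡s n≤4^s) ⟩
    x * x * 2 ^ (2 * s)         ≡⟨ exponents ⟩
    2 ^ (p * 4)                 ≤⟨ halfCentralBinomial-lower-bound p ⟩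
    suc p * (h * h)             ∎) ⟩
  h * h                     ∎)
  where
  open ≤-Reasoning
  x = 2 ^ t
  h = halfCentralBinomial p
  s = p * 2 ∸ t
  t≤2p : t ≤ p * 2
  t≤2p = s≤s⁻¹ (s≤s⁻¹ (subst (_≤ suc p * 2) (+-comm t 2) t+2≤n))
  n∸t∸2≡s : suc p * 2 ∸ t ∸ 2 ≡ s
  n∸t∸2≡s = cong (_∸ 2) (+-∸-assoc 2 t≤2p)
  rearrange : ∀ p y → suc p * (y + y) ≡ y * suc (suc (p * 2))
  rearrange = solve-∀
  double-sum : ∀ t s → t + t + 2 * s ≡ 2 * (t + s)
  double-sum = solve-∀
  double-double : ∀ p → 2 * (p * 2) ≡ p * 4
  double-double = solve-∀
  exponents : x * x * 2 ^ (2 * s) ≡ 2 ^ (p * 4)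
  exponents = begin-equality
    x * x * 2 ^ (2 * s)         ≡⟨ cong (_* 2 ^ (2 * s)) (^-distribˡ-+-* 2 t t) ⟨
    2 ^ (t + t) * 2 ^ (2 * s)   ≡⟨ ^-distribˡ-+-* 2 (t + t) (2 * s) ⟨
    2 ^ (t + t + 2 * s)         ≡⟨ cong (2 ^_) (trans (double-sum t s) (cong (2 *_) (m+[n∸m]≡n t≤2p))) ⟩
    2 ^ (2 * (p * 2))           ≡⟨ cong (2 ^_) (double-double p) ⟩
    2 ^ (p * 4)                 ∎

balancedPoint : ∀ p → Fin (halfCentralBinomial p) → Vec Bool (suc p * 2)
balancedPoint p i = true ∷ combination (suc (p * 2)) p i

balancedPoints-crossing : ∀ p {i j} → i ≢ j →
                          CrossingPair (lookup (balancedPoint p i)) (lookup (balancedPoint p j))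
balancedPoints-crossing p {i} {j} i≢j =
  balanced⇒crossing (balancedPoint p i) (balancedPoint p j)
    (trans (weight-point i) (sym (weight-point j)))
    (subst (λ w → suc p * 2 ≡ w + w) (sym (weight-point i)) (length≡ p))
    (i≢j ∘ combination-injective (suc (p * 2)) p ∘ ∷-injectiveʳ)
    (s≤s z≤n)
  where
  weight-point : ∀ i → weight (balancedPoint p i) ≡ suc p
  weight-point i = cong suc (weight-combination (suc (p * 2)) p i)
  length≡ : ∀ p → suc p * 2 ≡ suc p + suc p
  length≡ = solve-∀

crossing-family⇒crossed-part : ∀ {m k} (g : Fin m → Cube n) →
  (∀ {i j} → i ≢ j → CrossingPair (g i) (g j)) → k < m → (f : Cube n → Fin k) →
  Σ (Cube n) λ x → Σ (Cube n) λ x' → (f x ≡ f x') × CrossingPair x x'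
crossing-family⇒crossed-part g crossing k<m f with pigeonhole k<m (f ∘ g)
... | i , j , i<j , fgi≡fgj = g i , g j , fgi≡fgj , crossing (<⇒≢ᶠ i<j)

lemma3p4 : Σ ℕ λ N → (n : ℕ) → N ≤ n → 2 ∣ n → (t : ℕ) → TBound n t →
    (f : Cube n → Fin (2 ^ t)) →
    Σ (Cube n) λ x → Σ (Cube n) λ x' → (f x ≡ f x') × CrossingPair x x'
-- No largeness assumption is needed: the bound holds for every even n.
lemma3p4 = 0 , λ where
  .(zero * 2) _ (divides zero refl) t (t+2≤0 , _) f → contradiction (≤-trans (m≤n+m 2 t) t+2≤0) λ ()
  .(suc p * 2) _ (divides (suc p) refl) t bound f →
    crossing-family⇒crossed-part (lookup ∘ balancedPoint p) (balancedPoints-crossing p)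
      (TBound⇒2^t<halfCentralBinomial p t bound) f
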